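{- Let $n\ge 3$ be an integer, $\mathbb{F}$ a field, and $f$ a well-covered weighting of the Sierpinski gasket graph $S_n$. Then $f(v)=0$ for all $v\in V(S_n)-\bigcup_{i=1}^3 C_i$, where $C_1,C_2,C_3$ are the simplicial cliques of $S_n$.
   Context: The Sierpinski gasket graphs are defined recursively: $S_1=K_3$, whose three vertices are its extreme vertices; $S_{n+1}$ is obtained from three copies of $S_n$ by identifying, for each pair of copies, one extreme vertex of one copy with one extreme vertex of the other (triangular Sierpinski arrangement); the three extreme vertices not identified are the extreme vertices of $S_{n+1}$. For $n\ge 2$ the simplicial cliques $C_1,C_2,C_3$ of $S_n$ are the three triangles $N[x]$ with $x$ an extreme vertex (the extreme vertices being exactly the vertices whose closed neighborhood is a maximal clique). A maximal independent set (MIS) is an independent set not properly contained in another; a weighting $f:V(G)\to\mathbb{F}$ is well-covered if $\sum_{v\in\mathcal{M}}f(v)$ is the same for every MIS $\mathcal{M}$. -}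

module Defs where

open import Level using (Level; _⊔_) renaming (suc to lsuc)
open import Data.Nat using (ℕ; zero; suc)
open import Data.Fin using (Fin; zero; suc)
open import Data.Bool using (Bool; true; false; if_then_else_)
open import Data.List using (List; []; _∷_; _++_; map; foldr; concatMap)
open import Data.Product using (_×_; _,_; ∃)
open import Data.Sum using (_⊎_)
open import Relation.Nullary using (¬_)
open import Relation.Binary.PropositionalEquality using (_≡_; _≢_)
open import Algebra.Bundles using (CommutativeRing)

record Field (c ℓ : Level) : Set (lsuc (c ⊔ ℓ)) where
  field
    commutativeRing : CommutativeRing c ℓ
  open CommutativeRing commutativeRing public
  field
    0≉1     : ¬ (0# ≈ 1#)
    inverse : ∀ x → ¬ (x ≈ 0#) → ∃ λ y → x * y ≈ 1#

-- Non-extreme vertices of S_(n+1): for each k, the vertex 'mid k' at which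
-- the two copies other than copy k are glued, plus, for each copy i, the
-- non-extreme vertices of that copy of S_n.  (S_1 = K_3 has none.)

data Inner : ℕ → Set where
  mid : ∀ {n} → Fin 3 → Inner (suc (suc n))
  sub : ∀ {n} → Fin 3 → Inner (suc n) → Inner (suc (suc n))

data Vtx (n : ℕ) : Set where
  ext : Fin 3 → Vtx n
  inn : Inner n → Vtx n

-- Embedding of copy i of S_(n+1) into S_(n+2): extreme vertex i of copy i
-- is extreme vertex i of the big graph; extreme vertex j ≠ i of copy i is
-- glued with extreme vertex i of copy j, giving 'mid k' with {i,j,k} = {0,1,2}.
emb : ∀ {n} → Fin 3 → Vtx (suc n) → Vtx (suc (suc n))
emb zero             (ext zero)             = ext zero
emb zero             (ext (suc zero))       = inn (mid (suc (suc zero)))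
emb zero             (ext (suc (suc zero))) = inn (mid (suc zero))
emb (suc zero)       (ext zero)             = inn (mid (suc (suc zero)))
emb (suc zero)       (ext (suc zero))       = ext (suc zero)
emb (suc zero)       (ext (suc (suc zero))) = inn (mid zero)
emb (suc (suc zero)) (ext zero)             = inn (mid (suc zero))
emb (suc (suc zero)) (ext (suc zero))       = inn (mid zero)
emb (suc (suc zero)) (ext (suc (suc zero))) = ext (suc (suc zero))
emb i                (inn u)                = inn (sub i u)

data Adj : (n : ℕ) → Vtx n → Vtx n → Set where
  base : ∀ {i j : Fin 3} → i ≢ j → Adj 1 (ext i) (ext j)
  lift : ∀ {n} (i : Fin 3) {x y : Vtx (suc n)} →
         Adj (suc n) x y → Adj (suc (suc n)) (emb i x) (emb i y)

fins3 : List (Fin 3)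
fins3 = zero ∷ suc zero ∷ suc (suc zero) ∷ []

allInner : (n : ℕ) → List (Inner n)
allInner zero          = []
allInner (suc zero)    = []
allInner (suc (suc n)) =
  map mid fins3 ++ concatMap (λ i → map (sub i) (allInner (suc n))) fins3

allV : (n : ℕ) → List (Vtx n)
allV n = map ext fins3 ++ map inn (allInner n)

VSet : ℕ → Set
VSet n = Vtx n → Bool

_⊆ᵥ_ : ∀ {n} → VSet n → VSet n → Set
S ⊆ᵥ T = ∀ v → S v ≡ true → T v ≡ true

Independent : (n : ℕ) → VSet n → Set
Independent n S = ∀ x y → S x ≡ true → S y ≡ true → ¬ Adj n x y

MaximalIndependent : (n : ℕ) → VSet n → Set
MaximalIndependent n S =
  Independent n S × (∀ T → Independent n T → S ⊆ᵥ T → T ⊆ᵥ S)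

module _ {c ℓ} (F : Field c ℓ) where
  open Field F

  weightOf : ∀ {n} → (Vtx n → Carrier) → VSet n → Carrier
  weightOf {n} f S = foldr (λ v acc → (if S v then f v else 0#) + acc) 0# (allV n)

  WellCovered : (n : ℕ) → (Vtx n → Carrier) → Set ℓ
  WellCovered n f = ∀ S T → MaximalIndependent n S → MaximalIndependent n T →
                    weightOf f S ≈ weightOf f T

-- Simplicial clique C_i = N[x_i], the closed neighbourhood of extreme vertex x_i.
InSimplicialClique : (n : ℕ) → Fin 3 → Vtx n → Set
InSimplicialClique n i v = v ≡ ext i ⊎ Adj n (ext i) v

module Submission where

-- Well-coveredness is used only through an exchange property (Swappable): if A and B
-- are independent sets of inner vertices with the same closed neighbourhood, then
-- f(A) = f(B), since an independent dominating set containing A remains one when A is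
-- replaced by B (wellCovered⇒swappable).  The exchange property descends from S_(n+1)
-- to its three copies (swappable-copy), and the theorem follows by induction
-- (vanishing): in S_3 finitely many exchanges kill every vertex off the cliques; in
-- S_(n+1) a vertex of copy i off the cliques of copy i vanishes by induction, and one in
-- the clique of copy i at a corner e ≠ i lies next to the glue vertex of copies i and e,
-- where exchanges inside the two corner blocks (copies of S_3) meeting there kill it
-- (near-glue).  Such exchanges are certified by a decidable check on a Chart.

open import Defs
open import Data.Nat using (ℕ; zero; suc; _≥_; z≤n; s≤s)
import Data.Nat as ℕ
open import Data.Fin using (Fin; zero; suc)
open import Data.Fin.Properties using () renaming (_≟_ to _≟ᶠ_; any? to anyFin?; all? to allFin?)
open import Data.Bool using (true; false; _∧_; _∨_; not; if_then_else_)
import Data.Bool.Properties as Bool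
open import Data.List using (List; []; _∷_; _++_; map; foldr; filter; concatMap)
open import Data.List.Relation.Unary.Any as Any using (Any; here; there)
import Data.List.Relation.Unary.Any.Properties as AnyP
open import Data.List.Relation.Unary.All as All using (All; []; _∷_)
open import Data.List.Membership.Propositional using (_∈_; _∉_; find; lose)
open import Data.List.Membership.Propositional.Properties
  using (∈-map⁺; ∈-map⁻; ∈-++⁺ˡ; ∈-++⁺ʳ; ∈-++⁻; ∈-filter⁺; ∈-filter⁻; ∈-concat⁻′)
open import Data.List.Relation.Unary.AllPairs as AllPairs using (AllPairs; []; _∷_)
import Data.List.Relation.Unary.AllPairs.Properties as AllPairsP
open import Data.List.Relation.Unary.Unique.Propositional using (Unique)
import Data.List.Relation.Unary.Unique.Propositional.Properties as Unique
open import Data.List.Relation.Binary.Pointwise using (Pointwise; []; _∷_)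
open import Data.Product using (_×_; _,_; ∃; ∃₂; proj₁; proj₂)
open import Data.Sum using (_⊎_; inj₁; inj₂)
open import Data.Empty using (⊥; ⊥-elim)
open import Data.Unit using (tt)
open import Function using (_∘_)
open import Relation.Nullary using (¬_; Dec; yes; no; does)
open import Relation.Nullary.Decidable using (map′; _×-dec_; _⊎-dec_; _→-dec_; ¬?; True; toWitness; dec-true; dec-false)
open import Relation.Binary.PropositionalEquality
  using (_≡_; _≢_; refl; sym; trans; cong; cong₂; subst; subst₂)
open import Algebra.Bundles using (AbelianGroup)
import Algebra.Properties.Group as GroupProperties
import Algebra.Properties.CommutativeSemigroup as CSProperties

pattern c₀ = zero
pattern c₁ = suc zero
pattern c₂ = suc (suc zero)

third : Fin 3 → Fin 3 → Fin 3
third c₀ c₁ = c₂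
third c₀ c₂ = c₁
third c₁ c₀ = c₂
third c₁ c₂ = c₀
third c₂ c₀ = c₁
third c₂ c₁ = c₀
third a  _  = a

every-corner : {P : Fin 3 → Set} (P? : ∀ a → Dec (P a)) →
               True (P? c₀) → True (P? c₁) → True (P? c₂) → ∀ a → P a
every-corner P? p₀ p₁ p₂ c₀ = toWitness p₀
every-corner P? p₀ p₁ p₂ c₁ = toWitness p₁
every-corner P? p₀ p₁ p₂ c₂ = toWitness p₂

distinct-pairs : {P : (a b : Fin 3) → a ≢ b → Set} (P? : ∀ a b ne → Dec (P a b ne)) →
                 (∀ ne → True (P? c₀ c₁ ne)) → (∀ ne → True (P? c₀ c₂ ne)) →
                 (∀ ne → True (P? c₁ c₀ ne)) → (∀ ne → True (P? c₁ c₂ ne)) →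
                 (∀ ne → True (P? c₂ c₀ ne)) → (∀ ne → True (P? c₂ c₁ ne)) →
                 ∀ a b ne → P a b ne
distinct-pairs P? p₀₁ p₀₂ p₁₀ p₁₂ p₂₀ p₂₁ = decided
  where
  decided : ∀ a b ne → _
  decided c₀ c₁ ne = toWitness (p₀₁ ne)
  decided c₀ c₂ ne = toWitness (p₀₂ ne)
  decided c₁ c₀ ne = toWitness (p₁₀ ne)
  decided c₁ c₂ ne = toWitness (p₁₂ ne)
  decided c₂ c₀ ne = toWitness (p₂₀ ne)
  decided c₂ c₁ ne = toWitness (p₂₁ ne)
  decided c₀ c₀ ne = ⊥-elim (ne refl)
  decided c₁ c₁ ne = ⊥-elim (ne refl)
  decided c₂ c₂ ne = ⊥-elim (ne refl)

third-comm : ∀ i e → i ≢ e → third i e ≡ third e i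
third-comm = distinct-pairs (λ i e _ → third i e ≟ᶠ third e i)
  (λ _ → tt) (λ _ → tt) (λ _ → tt) (λ _ → tt) (λ _ → tt) (λ _ → tt)

third-≢ : ∀ a b → a ≢ b → a ≢ third a b
third-≢ = distinct-pairs (λ a b _ → ¬? (a ≟ᶠ third a b))
  (λ _ → tt) (λ _ → tt) (λ _ → tt) (λ _ → tt) (λ _ → tt) (λ _ → tt)

emb-corner : ∀ {n} i → emb {n} i (ext i) ≡ ext i
emb-corner c₀ = refl
emb-corner c₁ = refl
emb-corner c₂ = refl

emb-inn : ∀ {n} i (u : Inner (suc n)) → emb i (inn u) ≡ inn (sub i u)
emb-inn c₀ u = refl
emb-inn c₁ u = refl
emb-inn c₂ u = refl

retract : ∀ {n} → Fin 3 → Vtx (suc (suc n)) → Vtx (suc n)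
retract i (ext e)         = ext e
retract i (inn (mid m))   = ext (third i m)
retract i (inn (sub _ u)) = inn u

retract-emb : ∀ {n} i (x : Vtx (suc n)) → retract i (emb i x) ≡ x
retract-emb c₀ (ext c₀) = refl
retract-emb c₀ (ext c₁) = refl
retract-emb c₀ (ext c₂) = refl
retract-emb c₁ (ext c₀) = refl
retract-emb c₁ (ext c₁) = refl
retract-emb c₁ (ext c₂) = refl
retract-emb c₂ (ext c₀) = refl
retract-emb c₂ (ext c₁) = refl
retract-emb c₂ (ext c₂) = refl
retract-emb i  (inn u)  = cong (retract i) (emb-inn i u)

emb-injective : ∀ {n} i {x y : Vtx (suc n)} → emb i x ≡ emb i y → x ≡ y
emb-injective i {x} {y} eq =
  trans (sym (retract-emb i x)) (trans (cong (retract i) eq) (retract-emb i y))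

_≟ᴵ_ : ∀ {n} (u v : Inner n) → Dec (u ≡ v)
mid a   ≟ᴵ mid b   = map′ (cong mid) (λ { refl → refl }) (a ≟ᶠ b)
mid _   ≟ᴵ sub _ _ = no λ ()
sub _ _ ≟ᴵ mid _   = no λ ()
sub a u ≟ᴵ sub b v = map′ (λ { (refl , refl) → refl }) (λ { refl → refl , refl }) ((a ≟ᶠ b) ×-dec (u ≟ᴵ v))

_≟ⱽ_ : ∀ {n} (v w : Vtx n) → Dec (v ≡ w)
ext a ≟ⱽ ext b = map′ (cong ext) (λ { refl → refl }) (a ≟ᶠ b)
ext _ ≟ⱽ inn _ = no λ ()
inn _ ≟ⱽ ext _ = no λ ()
inn u ≟ⱽ inn v = map′ (cong inn) (λ { refl → refl }) (u ≟ᴵ v)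

emb-glue : ∀ {n} i e → i ≢ e → emb {n} i (ext e) ≡ inn (mid (third i e))
emb-glue {n} = distinct-pairs (λ i e _ → emb {n} i (ext e) ≟ⱽ inn (mid (third i e)))
  (λ _ → tt) (λ _ → tt) (λ _ → tt) (λ _ → tt) (λ _ → tt) (λ _ → tt)

emb-into-ext : ∀ {n} a (x : Vtx (suc n)) {e} → emb a x ≡ ext e → a ≡ e × x ≡ ext e
emb-into-ext a x {e} eq with trans (sym (retract-emb a x)) (cong (retract a) eq)
... | refl with a ≟ᶠ e
...   | yes a≡e = a≡e , refl
...   | no a≢e with trans (sym (emb-glue a e a≢e)) eq
...     | ()

emb-into-sub : ∀ {n} a (x : Vtx (suc (suc n))) {b u} → emb a x ≡ inn (sub b u) → a ≡ b × x ≡ inn u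
emb-into-sub a x eq with trans (sym (retract-emb a x)) (cong (retract a) eq)
... | refl with trans (sym (emb-inn a _)) eq
...   | refl = refl , refl

emb-overlap-ext : ∀ {n} a b → a ≢ b → ∀ c d → emb {n} a (ext c) ≡ emb b (ext d) → c ≡ b × d ≡ a
emb-overlap-ext {n} = distinct-pairs
  (λ a b _ → allFin? λ c → allFin? λ d → (emb {n} a (ext c) ≟ⱽ emb b (ext d)) →-dec ((c ≟ᶠ b) ×-dec (d ≟ᶠ a)))
  (λ _ → tt) (λ _ → tt) (λ _ → tt) (λ _ → tt) (λ _ → tt) (λ _ → tt)

emb-overlap : ∀ {n} a b (x y : Vtx (suc n)) → a ≢ b → emb a x ≡ emb b y → x ≡ ext b × y ≡ ext a
emb-overlap a b (ext c) (ext d) a≢b eq with emb-overlap-ext a b a≢b c d eq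
... | refl , refl = refl , refl
emb-overlap {suc n} a b (inn u) y a≢b eq =
  ⊥-elim (a≢b (sym (proj₁ (emb-into-sub b y (trans (sym eq) (emb-inn a u))))))
emb-overlap {suc n} a b (ext c) (inn w) a≢b eq =
  ⊥-elim (a≢b (proj₁ (emb-into-sub a (ext c) (trans eq (emb-inn b w)))))

adj-sym : ∀ {n v w} → Adj n v w → Adj n w v
adj-sym (base a≢b) = base (a≢b ∘ sym)
adj-sym (lift i p) = lift i (adj-sym p)

adj-irrefl : ∀ {n v w} → Adj n v w → v ≢ w
adj-irrefl (base a≢b) refl = a≢b refl
adj-irrefl (lift i p) eq   = adj-irrefl p (emb-injective i eq)

adj? : ∀ n (v w : Vtx n) → Dec (Adj n v w)
adj? zero v w = no λ ()
adj? (suc zero) (ext a) (ext b) = map′ base (λ { (base a≢b) → a≢b }) (¬? (a ≟ᶠ b))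
adj? (suc (suc n)) v w = map′ sound complete (anyFin? λ i → inCopy i v ×-dec inCopy i w ×-dec adj? (suc n) (retract i v) (retract i w))
  where
  inCopy : (i : Fin 3) (x : Vtx (suc (suc n))) → Dec (emb i (retract i x) ≡ x)
  inCopy i x = emb i (retract i x) ≟ⱽ x
  sound : (∃ λ i → emb i (retract i v) ≡ v × emb i (retract i w) ≡ w × Adj (suc n) (retract i v) (retract i w)) → Adj (suc (suc n)) v w
  sound (i , ev , ew , p) = subst₂ (Adj (suc (suc n))) ev ew (lift i p)
  complete : Adj (suc (suc n)) v w → ∃ λ i → emb i (retract i v) ≡ v × emb i (retract i w) ≡ w × Adj (suc n) (retract i v) (retract i w)
  complete (lift i {x} {y} p) =
    i , cong (emb i) (retract-emb i x) , cong (emb i) (retract-emb i y) ,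
    subst₂ (Adj (suc n)) (sym (retract-emb i x)) (sym (retract-emb i y)) p

adj-in-copy : ∀ {n v w} → Adj (suc (suc n)) v w →
              ∃ λ i → ∃₂ λ x y → v ≡ emb i x × w ≡ emb i y × Adj (suc n) x y
adj-in-copy (lift i p) = i , _ , _ , refl , refl , p

emb-neighbour : ∀ {n} i (x : Vtx (suc n)) {w} → Adj (suc (suc n)) (emb i x) w →
                (∃ λ y → w ≡ emb i y × Adj (suc n) x y) ⊎
                (∃ λ e → e ≢ i × x ≡ ext e × ∃ λ y → w ≡ emb e y × Adj (suc n) (ext i) y)
emb-neighbour i x a with adj-in-copy a
... | j , x′ , y , ex , refl , p with i ≟ᶠ j
...   | yes refl = inj₁ (y , refl , subst (λ z → Adj _ z y) (sym (emb-injective i ex)) p)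
...   | no i≢j with emb-overlap i j x x′ i≢j ex
...     | refl , refl = inj₂ (j , i≢j ∘ sym , refl , y , refl , p)

sub-neighbour : ∀ {n} i (u : Inner (suc n)) {w} → Adj (suc (suc n)) (inn (sub i u)) w →
                ∃ λ y → w ≡ emb i y × Adj (suc n) (inn u) y
sub-neighbour i u a with emb-neighbour i (inn u) (subst (λ z → Adj _ z _) (sym (emb-inn i u)) a)
... | inj₁ nb = nb
... | inj₂ (_ , _ , () , _)

-- Each vertex is listed in allV n, exactly once; this makes weights of singletons exact.
fins3-complete : ∀ (a : Fin 3) → a ∈ fins3
fins3-complete c₀ = here refl
fins3-complete c₁ = there (here refl)
fins3-complete c₂ = there (there (here refl))

fins3-unique : Unique fins3
fins3-unique = ((λ ()) ∷ (λ ()) ∷ []) ∷ ((λ ()) ∷ []) ∷ [] ∷ []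

∈-allInner : ∀ n (u : Inner n) → u ∈ allInner n
∈-allInner (suc (suc n)) (mid a)   = ∈-++⁺ˡ (∈-map⁺ mid (fins3-complete a))
∈-allInner (suc (suc n)) (sub a u) = ∈-++⁺ʳ (map mid fins3) (copy a (∈-map⁺ (sub a) (∈-allInner (suc n) u)))
  where
  L = allInner (suc n)
  copy : ∀ a {v} → v ∈ map (sub a) L → v ∈ map (sub c₀) L ++ map (sub c₁) L ++ map (sub c₂) L ++ []
  copy c₀ m = ∈-++⁺ˡ m
  copy c₁ m = ∈-++⁺ʳ (map (sub c₀) L) (∈-++⁺ˡ m)
  copy c₂ m = ∈-++⁺ʳ (map (sub c₀) L) (∈-++⁺ʳ (map (sub c₁) L) (∈-++⁺ˡ m))

∈-allV : ∀ n (v : Vtx n) → v ∈ allV n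
∈-allV n (ext a) = ∈-++⁺ˡ (∈-map⁺ ext (fins3-complete a))
∈-allV n (inn u) = ∈-++⁺ʳ (map ext fins3) (∈-map⁺ inn (∈-allInner n u))

unique-allInner : ∀ n → Unique (allInner n)
unique-allInner zero          = []
unique-allInner (suc zero)    = []
unique-allInner (suc (suc n)) =
  Unique.++⁺ (Unique.map⁺ {f = mid} (λ { refl → refl }) fins3-unique)
             (Unique.concat⁺ (copy c₀ (unique-allInner (suc n)) ∷ copy c₁ (unique-allInner (suc n)) ∷
                              copy c₂ (unique-allInner (suc n)) ∷ [])
                             ((apart (λ ()) ∷ apart (λ ()) ∷ []) ∷ (apart (λ ()) ∷ []) ∷ [] ∷ []))
             mids-apart
  where
  L = allInner (suc n)
  copy : ∀ a → Unique L → Unique (map (sub a) L)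
  copy a = Unique.map⁺ {f = sub a} (λ { refl → refl })
  apart : ∀ {a b} → a ≢ b → ∀ {v} → ¬ (v ∈ map (sub a) L × v ∈ map (sub b) L)
  apart a≢b (m , m′) with ∈-map⁻ (sub _) m | ∈-map⁻ (sub _) m′
  ... | _ , _ , refl | _ , _ , refl = a≢b refl
  mids-apart : ∀ {v} → ¬ (v ∈ map mid fins3 × v ∈ concatMap (λ a → map (sub a) L) fins3)
  mids-apart (m , m′) with ∈-map⁻ mid m | ∈-concat⁻′ (map (λ a → map (sub a) L) fins3) m′
  ... | _ , _ , refl | _ , m″ , xs∈ with ∈-map⁻ (λ a → map (sub a) L) xs∈
  ...   | a , _ , refl with ∈-map⁻ (sub a) m″
  ...     | _ , _ , ()

unique-allV : ∀ n → Unique (allV n)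
unique-allV n = Unique.++⁺ (Unique.map⁺ {f = ext} (λ { refl → refl }) fins3-unique)
                           (Unique.map⁺ {f = inn} (λ { refl → refl }) (unique-allInner n))
                           λ (m , m′) → ext≢inn (∈-map⁻ ext m) (∈-map⁻ inn m′)
  where
  ext≢inn : ∀ {v : Vtx n} → (∃ λ a → a ∈ fins3 × v ≡ ext a) → ¬ (∃ λ u → u ∈ allInner n × v ≡ inn u)
  ext≢inn (_ , _ , refl) (_ , _ , ())

neighbours : ∀ n → Vtx n → List (Vtx n)
neighbours n v = filter (adj? n v) (allV n)

neighbours-complete : ∀ n v {w} → Adj n v w → w ∈ neighbours n v
neighbours-complete n v {w} a = ∈-filter⁺ (adj? n v) (∈-allV n w) a

neighbours-sound : ∀ n v {w} → w ∈ neighbours n v → Adj n v w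
neighbours-sound n v m = proj₂ (∈-filter⁻ (adj? n v) m)

-- The corner block at corner e: a copy of S_3 inside S_(3+k), reached by descending
-- k times into copy e.  Around a glue vertex of S_(4+k) two such blocks meet.
block : ∀ k → Fin 3 → Vtx 3 → Vtx (3 ℕ.+ k)
block zero    e v = v
block (suc k) e v = emb e (block k e v)

block-inner : ∀ k → Fin 3 → Inner 3 → Inner (3 ℕ.+ k)
block-inner zero    e u = u
block-inner (suc k) e u = sub e (block-inner k e u)

block-inn : ∀ k e u → block k e (inn u) ≡ inn (block-inner k e u)
block-inn zero    e u = refl
block-inn (suc k) e u = trans (cong (emb e) (block-inn k e u)) (emb-inn e (block-inner k e u))

block-corner : ∀ k e → block k e (ext e) ≡ ext e
block-corner zero    e = refl
block-corner (suc k) e = trans (cong (emb e) (block-corner k e)) (emb-corner e)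

block-adj : ∀ k e {x y} → Adj 3 x y → Adj (3 ℕ.+ k) (block k e x) (block k e y)
block-adj zero    e p = p
block-adj (suc k) e p = lift e (block-adj k e p)

block-injective : ∀ k e {x y} → block k e x ≡ block k e y → x ≡ y
block-injective zero    e eq = eq
block-injective (suc k) e eq = block-injective k e (emb-injective e eq)

block-at-corner : ∀ k e {v} → block k e v ≡ ext e → v ≡ ext e
block-at-corner zero    e eq = eq
block-at-corner (suc k) e eq = block-at-corner k e (proj₂ (emb-into-ext e _ eq))

block-inner-not-ext : ∀ k e u {e′} → block k e (inn u) ≢ ext e′
block-inner-not-ext k e u eq with trans (sym (block-inn k e u)) eq
... | ()

-- The vertices of S_3 whose whole neighbourhood stays inside the corner block at e.
data Interior (e : Fin 3) : Vtx 3 → Set where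
  inner  : ∀ u → Interior e (inn u)
  corner : Interior e (ext e)

interior-not-corner : ∀ k e {x e′} → Interior e x → block k e x ≡ ext e′ → e′ ≡ e
interior-not-corner k e (inner u) eq = ⊥-elim (block-inner-not-ext k e u eq)
interior-not-corner k e corner eq with trans (sym (block-corner k e)) eq
... | refl = refl

block-neighbour : ∀ k e {x w} → Interior e x → Adj (3 ℕ.+ k) (block k e x) w →
                  ∃ λ y → w ≡ block k e y × Adj 3 x y
block-neighbour zero    e int a = _ , refl , a
block-neighbour (suc k) e int a with emb-neighbour e (block k e _) a
... | inj₁ (y′ , refl , p) with block-neighbour k e int p
...   | y , refl , q = y , refl , q
block-neighbour (suc k) e int a | inj₂ (_ , e′≢e , eq , _) = ⊥-elim (e′≢e (interior-not-corner k e int eq))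

block-clique : ∀ k e {x j} → Interior e x → InSimplicialClique (3 ℕ.+ k) j (block k e x) →
               InSimplicialClique 3 j x
block-clique zero    e int c = c
block-clique (suc k) e {x} int (inj₁ eq) with emb-into-ext e (block k e x) eq
... | refl , eq′ = block-clique k e int (inj₁ eq′)
block-clique (suc k) e {x} int (inj₂ a) with emb-neighbour e (block k e x) (adj-sym a)
... | inj₁ (y , eq , p) with emb-into-ext e y (sym eq)
...   | refl , refl = block-clique k e int (inj₂ (adj-sym p))
block-clique (suc k) e int (inj₂ a) | inj₂ (_ , e′≢e , eq , _) = ⊥-elim (e′≢e (interior-not-corner k e int eq))

NonClique : (n : ℕ) → Vtx n → Set
NonClique n v = ∀ j → ¬ InSimplicialClique n j v

clique? : ∀ n v → Dec (∃ λ j → InSimplicialClique n j v)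
clique? n v = anyFin? λ j → (v ≟ⱽ ext j) ⊎-dec adj? n (ext j) v

clique-emb : ∀ {n} i {x : Vtx (suc n)} → InSimplicialClique (suc n) i x →
             InSimplicialClique (suc (suc n)) i (emb i x)
clique-emb i (inj₁ refl) = inj₁ (emb-corner i)
clique-emb i {x} (inj₂ a) = inj₂ (subst (λ z → Adj _ z (emb i x)) (emb-corner i) (lift i a))

in-some-copy : ∀ {n} (v : Vtx (suc (suc n))) → ∃₂ λ i x → v ≡ emb i x
in-some-copy (ext e)         = e , ext e , sym (emb-corner e)
in-some-copy (inn (mid c₀))  = c₁ , ext c₂ , refl
in-some-copy (inn (mid c₁))  = c₀ , ext c₂ , refl
in-some-copy (inn (mid c₂))  = c₀ , ext c₁ , refl
in-some-copy (inn (sub i u)) = i , inn u , sym (emb-inn i u)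

nonClique? : ∀ n v → Dec (NonClique n v)
nonClique? n v = map′ (λ ¬c j c → ¬c (j , c)) (λ nc (j , c) → nc j c) (¬? (clique? n v))

next : Fin 3 → Fin 3
next c₀ = c₁
next c₁ = c₂
next c₂ = c₀

next-≢ : ∀ a → a ≢ next a
next-≢ = every-corner (λ a → ¬? (a ≟ᶠ next a)) tt tt tt

-- Facts about S_3, by computation.  Outside its simplicial cliques lie exactly the mids
-- and the vertices sub a (mid a); the neighbours of ext e are the two sub e (mid a).
mid-nonclique : ∀ a → NonClique 3 (inn (mid a))
mid-nonclique = every-corner (λ a → nonClique? 3 (inn (mid a))) tt tt tt

centre-nonclique : ∀ a → NonClique 3 (inn (sub a (mid a)))
centre-nonclique = every-corner (λ a → nonClique? 3 (inn (sub a (mid a)))) tt tt tt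

corner-adjacent : ∀ a b → a ≢ b → Adj 3 (ext a) (inn (sub a (mid b)))
corner-adjacent = distinct-pairs (λ a b _ → adj? 3 (ext a) (inn (sub a (mid b))))
  (λ _ → tt) (λ _ → tt) (λ _ → tt) (λ _ → tt) (λ _ → tt) (λ _ → tt)

corner-neighbours : ∀ i e → i ≢ e →
                    All (λ y → y ≡ inn (sub e (mid i)) ⊎ y ≡ inn (sub e (mid (third i e)))) (neighbours 3 (ext e))
corner-neighbours = distinct-pairs
  (λ i e _ → All.all? (λ y → (y ≟ⱽ inn (sub e (mid i))) ⊎-dec (y ≟ⱽ inn (sub e (mid (third i e))))) (neighbours 3 (ext e)))
  (λ _ → tt) (λ _ → tt) (λ _ → tt) (λ _ → tt) (λ _ → tt) (λ _ → tt)

_∪_ : ∀ {n} → VSet n → VSet n → VSet n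
(S ∪ T) v = S v ∨ T v

_∖_ : ∀ {n} → VSet n → VSet n → VSet n
(S ∖ T) v = S v ∧ not (T v)

⟨_⟩ : ∀ {n} → Vtx n → VSet n
⟨ x ⟩ v = does (x ≟ⱽ v)

from-does : ∀ {P : Set} (d : Dec P) → does d ≡ true → P
from-does (yes p) _ = p

∪-introˡ : ∀ {n} (S T : VSet n) {v} → S v ≡ true → (S ∪ T) v ≡ true
∪-introˡ S T {v} Sv rewrite Sv = refl

∪-introʳ : ∀ {n} (S T : VSet n) {v} → T v ≡ true → (S ∪ T) v ≡ true
∪-introʳ S T {v} Tv rewrite Tv = Bool.∨-zeroʳ (S v)

∪-elim : ∀ {n} (S T : VSet n) {v} → (S ∪ T) v ≡ true → S v ≡ true ⊎ T v ≡ true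
∪-elim S T {v} h with S v
... | true  = inj₁ refl
... | false = inj₂ h

Dominated : ∀ n → VSet n → Vtx n → Set
Dominated n S v = ∃ λ u → S u ≡ true × Adj n u v

dominated? : ∀ n S v → Dec (Dominated n S v)
dominated? n S v =
  map′ (λ d → let u , _ , p = find d in u , p) (λ (u , p) → lose (∈-allV n u) p)
       (Any.any? (λ u → (S u Bool.≟ true) ×-dec adj? n u v) (allV n))

Dominating : ∀ n → VSet n → Set
Dominating n S = ∀ v → S v ≡ true ⊎ Dominated n S v

dominating⇒maximal : ∀ {n S} → Independent n S → Dominating n S → MaximalIndependent n S
dominating⇒maximal {n} {S} indS dom = indS , λ T indT S⊆T v Tv → kept T indT S⊆T v Tv (dom v)
  where
  kept : ∀ T → Independent n T → S ⊆ᵥ T → ∀ v → T v ≡ true → S v ≡ true ⊎ Dominated n S v → S v ≡ true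
  kept T indT S⊆T v Tv (inj₁ Sv)            = Sv
  kept T indT S⊆T v Tv (inj₂ (u , Su , a)) = ⊥-elim (indT u v (S⊆T u Su) Tv a)

module Greedy (n : ℕ) where

  extend : VSet n → Vtx n → VSet n
  extend S v with dominated? n S v
  ... | yes _ = S
  ... | no _  = S ∪ ⟨ v ⟩

  extend-mono : ∀ S v → S ⊆ᵥ extend S v
  extend-mono S v w Sw with dominated? n S v
  ... | yes _ = Sw
  ... | no _  = ∪-introˡ S ⟨ v ⟩ Sw

  extend-independent : ∀ S v → Independent n S → Independent n (extend S v)
  extend-independent S v indS with dominated? n S v
  ... | yes _  = indS
  ... | no ¬dv = λ x y Sx Sy a → added x y (∪-elim S ⟨ v ⟩ Sx) (∪-elim S ⟨ v ⟩ Sy) a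
    where
    added : ∀ x y → S x ≡ true ⊎ ⟨ v ⟩ x ≡ true → S y ≡ true ⊎ ⟨ v ⟩ y ≡ true → ¬ Adj n x y
    added x y (inj₁ Sx) (inj₁ Sy) a = indS x y Sx Sy a
    added x y (inj₁ Sx) (inj₂ vy) a with from-does (v ≟ⱽ y) vy
    ... | refl = ¬dv (x , Sx , a)
    added x y (inj₂ vx) (inj₁ Sy) a with from-does (v ≟ⱽ x) vx
    ... | refl = ¬dv (y , Sy , adj-sym a)
    added x y (inj₂ vx) (inj₂ vy) a with from-does (v ≟ⱽ x) vx | from-does (v ≟ⱽ y) vy
    ... | refl | refl = adj-irrefl a refl

  extend-covers : ∀ S v → extend S v v ≡ true ⊎ Dominated n (extend S v) v
  extend-covers S v with dominated? n S v
  ... | yes d = inj₂ d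
  ... | no _  = inj₁ (∪-introʳ S ⟨ v ⟩ (dec-true (v ≟ⱽ v) refl))

  greedy : VSet n → List (Vtx n) → VSet n
  greedy S []       = S
  greedy S (v ∷ vs) = greedy (extend S v) vs

  greedy-mono : ∀ S L → S ⊆ᵥ greedy S L
  greedy-mono S []       w Sw = Sw
  greedy-mono S (v ∷ vs) w Sw = greedy-mono (extend S v) vs w (extend-mono S v w Sw)

  greedy-independent : ∀ S L → Independent n S → Independent n (greedy S L)
  greedy-independent S []       indS = indS
  greedy-independent S (v ∷ vs) indS = greedy-independent (extend S v) vs (extend-independent S v indS)

  greedy-covers : ∀ S L {v} → v ∈ L → greedy S L v ≡ true ⊎ Dominated n (greedy S L) v
  greedy-covers S (v ∷ vs) (here refl) with extend-covers S v
  ... | inj₁ in-set       = inj₁ (greedy-mono (extend S v) vs v in-set)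
  ... | inj₂ (u , Su , a) = inj₂ (u , greedy-mono (extend S v) vs u Su , a)
  greedy-covers S (w ∷ vs) (there m) = greedy-covers (extend S w) vs m

extend-to-dominating : ∀ n S → Independent n S → ∃ λ M → S ⊆ᵥ M × Independent n M × Dominating n M
extend-to-dominating n S indS =
  greedy S (allV n) , greedy-mono S (allV n) , greedy-independent S (allV n) indS ,
  λ v → greedy-covers S (allV n) (∈-allV n v)
  where open Greedy n

IndependentList : ∀ n → List (Inner n) → Set
IndependentList n A = ∀ {a b} → a ∈ A → b ∈ A → ¬ Adj n (inn a) (inn b)

N[_] : ∀ {n} → List (Inner n) → Vtx n → Set
N[_] {n} A w = Any (λ a → inn a ≡ w ⊎ Adj n (inn a) w) A

N[_]? : ∀ {n} (A : List (Inner n)) w → Dec (N[ A ] w)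
N[_]? {n} A w = Any.any? (λ a → (inn a ≟ⱽ w) ⊎-dec adj? n (inn a) w) A

record Exchangeable (n : ℕ) (A B : List (Inner n)) : Set where
  field
    uniqueˡ      : Unique A
    uniqueʳ      : Unique B
    independentˡ : IndependentList n A
    independentʳ : IndependentList n B
    coverˡ       : ∀ {w} → N[ A ] w → N[ B ] w
    coverʳ       : ∀ {w} → N[ B ] w → N[ A ] w

⟦_⟧ : ∀ {n} → List (Inner n) → VSet n
⟦ A ⟧ v = does (Any.any? (λ a → inn a ≟ⱽ v) A)

⟦⟧-sound : ∀ {n} (A : List (Inner n)) {w} → ⟦ A ⟧ w ≡ true → Any (λ a → inn a ≡ w) A
⟦⟧-sound A {w} = from-does (Any.any? (λ a → inn a ≟ⱽ w) A)

⟦⟧-complete : ∀ {n} (A : List (Inner n)) {a} → a ∈ A → ⟦ A ⟧ (inn a) ≡ true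
⟦⟧-complete A {a} m = dec-true (Any.any? (λ a′ → inn a′ ≟ⱽ inn a) A) (Any.map (λ eq → cong inn (sym eq)) m)

⟦⟧⊆N : ∀ {n} (A : List (Inner n)) {w} → ⟦ A ⟧ w ≡ true → N[ A ] w
⟦⟧⊆N A h = Any.map inj₁ (⟦⟧-sound A h)

⟦⟧-independent : ∀ {n} (A : List (Inner n)) → IndependentList n A → Independent n ⟦ A ⟧
⟦⟧-independent A ind x y Ax Ay with find (⟦⟧-sound A Ax) | find (⟦⟧-sound A Ay)
... | a , ma , refl | b , mb , refl = ind ma mb

N-copy⁻ : ∀ {n} i (A : List (Inner (suc n))) {w} → N[ map (sub i) A ] w → ∃ λ y → w ≡ emb i y × N[ A ] y
N-copy⁻ i A NAw with find (AnyP.map⁻ NAw)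
... | a , ma , inj₁ refl = inn a , sym (emb-inn i a) , lose ma (inj₁ refl)
... | a , ma , inj₂ adj with sub-neighbour i a adj
...   | y , refl , adj′ = y , refl , lose ma (inj₂ adj′)

N-copy⁺ : ∀ {n} i (A : List (Inner (suc n))) {y} → N[ A ] y → N[ map (sub i) A ] (emb i y)
N-copy⁺ i A NAy = AnyP.map⁺ (Any.map (λ {a} → into a) NAy)
  where
  into : ∀ a {y} → inn a ≡ y ⊎ Adj _ (inn a) y → inn (sub i a) ≡ emb i y ⊎ Adj _ (inn (sub i a)) (emb i y)
  into a (inj₁ refl) = inj₁ (sym (emb-inn i a))
  into a (inj₂ adj)  = inj₂ (subst (λ z → Adj _ z _) (emb-inn i a) (lift i adj))

exchangeable-copy : ∀ {n} i {A B : List (Inner (suc n))} → Exchangeable (suc n) A B →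
                    Exchangeable (suc (suc n)) (map (sub i) A) (map (sub i) B)
exchangeable-copy {n} i {A} {B} ex = record
  { uniqueˡ      = Unique.map⁺ {f = sub i} (λ { refl → refl }) uniqueˡ
  ; uniqueʳ      = Unique.map⁺ {f = sub i} (λ { refl → refl }) uniqueʳ
  ; independentˡ = independent A independentˡ
  ; independentʳ = independent B independentʳ
  ; coverˡ       = cover A B coverˡ
  ; coverʳ       = cover B A coverʳ
  }
  where
  open Exchangeable ex
  independent : ∀ L → IndependentList (suc n) L → IndependentList (suc (suc n)) (map (sub i) L)
  independent L ind ma mb adj with ∈-map⁻ (sub i) ma | ∈-map⁻ (sub i) mb
  ... | a , ma′ , refl | b , mb′ , refl with sub-neighbour i a adj
  ...   | y , eq , adj′ with emb-injective i (trans (emb-inn i b) eq)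
  ...     | refl = ind ma′ mb′ adj′
  cover : ∀ L L′ → (∀ {w} → N[ L ] w → N[ L′ ] w) → ∀ {w} → N[ map (sub i) L ] w → N[ map (sub i) L′ ] w
  cover L L′ cov NLw with N-copy⁻ i L NLw
  ... | y , refl , NLy = N-copy⁺ i L′ (cov NLy)

-- A chart of S_N: labels for finitely many vertices of S_N (equality of their images
-- being decidable), and members, i.e. inner vertices whose whole neighbourhood is
-- listed by labels.  Exchangeability of lists of members then becomes a finite check.
record Chart (N : ℕ) : Set₁ where
  field
    Label         : Set
    image         : Label → Vtx N
    sameImage?    : ∀ x y → Dec (image x ≡ image y)
    Member        : Set
    label         : Member → Label
    site          : Member → Inner N
    site-label    : ∀ m → inn (site m) ≡ image (label m)
    nbrs          : Member → List Label
    nbrs-complete : ∀ m {w} → Adj N (inn (site m)) w → Any (λ g → w ≡ image g) (nbrs m)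
    nbrs-sound    : ∀ m {g} → g ∈ nbrs m → Adj N (inn (site m)) (image g)

module ChartCheck {N} (C : Chart N) where
  open Chart C

  closed : Member → List Label
  closed m = label m ∷ nbrs m

  Separated : List Member → Set
  Separated = AllPairs (λ a b → image (label a) ≢ image (label b))

  Apart : List Member → Set
  Apart A = All (λ a → All (λ b → All (λ g → image (label b) ≢ image g) (nbrs a)) A) A

  Covers : List Member → List Member → Set
  Covers A B = All (λ a → All (λ g → Any (λ b → Any (λ h → image g ≡ image h) (closed b)) B) (closed a)) A

  Certificate : List Member → List Member → Set
  Certificate A B = Separated A × Separated B × Apart A × Apart B × Covers A B × Covers B A

  certificate? : ∀ A B → Dec (Certificate A B)
  certificate? A B = separated? A ×-dec separated? B ×-dec apart? A ×-dec apart? B ×-dec covers? A B ×-dec covers? B A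
    where
    separated? : ∀ A → Dec (Separated A)
    separated? = AllPairs.allPairs? λ a b → ¬? (sameImage? (label a) (label b))
    apart? : ∀ A → Dec (Apart A)
    apart? A = All.all? (λ a → All.all? (λ b → All.all? (λ g → ¬? (sameImage? (label b) g)) (nbrs a)) A) A
    covers? : ∀ A B → Dec (Covers A B)
    covers? A B = All.all? (λ a → All.all? (λ g → Any.any? (λ b → Any.any? (sameImage? g) (closed b)) B) (closed a)) A

  site-injective : ∀ {a b} → image (label a) ≢ image (label b) → site a ≢ site b
  site-injective {a} {b} ne eq = ne (trans (sym (site-label a)) (trans (cong inn eq) (site-label b)))

  separated⇒unique : ∀ {A} → Separated A → Unique (map site A)
  separated⇒unique sep = AllPairsP.map⁺ (AllPairs.map site-injective sep)

  apart⇒independent : ∀ {A} → Apart A → IndependentList N (map site A)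
  apart⇒independent apart ma mb adj with ∈-map⁻ site ma | ∈-map⁻ site mb
  ... | a , ma′ , refl | b , mb′ , refl with find (nbrs-complete a adj)
  ...   | g , mg , eq = All.lookup (All.lookup (All.lookup apart ma′) mb′) mg (trans (sym (site-label b)) eq)

  closed-label : ∀ a {w} → inn (site a) ≡ w ⊎ Adj N (inn (site a)) w → ∃ λ g → g ∈ closed a × w ≡ image g
  closed-label a (inj₁ refl) = label a , here refl , site-label a
  closed-label a (inj₂ adj) with find (nbrs-complete a adj)
  ... | g , mg , eq = g , there mg , eq

  closed-label⁻ : ∀ b {h w} → h ∈ closed b → w ≡ image h → inn (site b) ≡ w ⊎ Adj N (inn (site b)) w
  closed-label⁻ b (here refl) eq  = inj₁ (trans (site-label b) (sym eq))
  closed-label⁻ b (there mh) refl = inj₂ (nbrs-sound b mh)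

  covers⇒⊆ : ∀ {A B} → Covers A B → ∀ {w} → N[ map site A ] w → N[ map site B ] w
  covers⇒⊆ {A} {B} cov NAw with find (AnyP.map⁻ NAw)
  ... | a , ma , r with closed-label a r
  ...   | g , mg , refl with find (All.lookup (All.lookup cov ma) mg)
  ...     | b , mb , same with find same
  ...       | h , mh , eq = AnyP.map⁺ (lose mb (closed-label⁻ b mh eq))

  certificate⇒exchangeable : ∀ {A B} → Certificate A B → Exchangeable N (map site A) (map site B)
  certificate⇒exchangeable (sepA , sepB , apartA , apartB , covAB , covBA) = record
    { uniqueˡ      = separated⇒unique sepA
    ; uniqueʳ      = separated⇒unique sepB
    ; independentˡ = apart⇒independent apartA
    ; independentʳ = apart⇒independent apartB
    ; coverˡ       = covers⇒⊆ covAB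
    ; coverʳ       = covers⇒⊆ covBA
    }

baseChart : Chart 3
baseChart = record
  { Label         = Vtx 3
  ; image         = λ v → v
  ; sameImage?    = _≟ⱽ_
  ; Member        = Inner 3
  ; label         = inn
  ; site          = λ u → u
  ; site-label    = λ _ → refl
  ; nbrs          = λ u → neighbours 3 (inn u)
  ; nbrs-complete = λ u → neighbours-complete 3 (inn u)
  ; nbrs-sound    = λ u → neighbours-sound 3 (inn u)
  }

-- The exchanges in S_3 behind the base case, for distinct corners a, b and c = third a b
-- (left list against right list):
--   equal:  sub b (mid c) against sub b (mid a), next to sub c (mid a) and sub a (mid a);
--   mid:    mid a, sub c (mid b), sub b (mid c) against sub c (mid a), sub b (mid a),
--           both next to sub a (mid a);
--   corner: sub a (mid a) against mid c and mid b, next to sub c (mid a) and sub b (mid a).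
module BaseCertificates where
  open ChartCheck baseChart

  equalˡ equalʳ : Fin 3 → Fin 3 → List (Inner 3)
  equalˡ a b = sub b (mid (third a b)) ∷ sub (third a b) (mid a) ∷ sub a (mid a) ∷ []
  equalʳ a b = sub b (mid a)           ∷ sub (third a b) (mid a) ∷ sub a (mid a) ∷ []

  equal-certificate : ∀ a b → a ≢ b → Certificate (equalˡ a b) (equalʳ a b)
  equal-certificate = distinct-pairs
    (λ a b _ → certificate? (equalˡ a b) (equalʳ a b))
    (λ _ → tt) (λ _ → tt) (λ _ → tt) (λ _ → tt) (λ _ → tt) (λ _ → tt)

  midˡ midʳ : Fin 3 → Fin 3 → List (Inner 3)
  midˡ a b = mid a ∷ sub (third a b) (mid (third a (third a b))) ∷ sub b (mid (third a b)) ∷ sub a (mid a) ∷ []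
  midʳ a b = sub (third a b) (mid a) ∷ sub b (mid a) ∷ sub a (mid a) ∷ []

  mid-certificate : ∀ a b → a ≢ b → Certificate (midˡ a b) (midʳ a b)
  mid-certificate = distinct-pairs
    (λ a b _ → certificate? (midˡ a b) (midʳ a b))
    (λ _ → tt) (λ _ → tt) (λ _ → tt) (λ _ → tt) (λ _ → tt) (λ _ → tt)

  cornerˡ cornerʳ : Fin 3 → Fin 3 → List (Inner 3)
  cornerˡ a b = sub a (mid a) ∷ sub (third a b) (mid a) ∷ sub b (mid a) ∷ []
  cornerʳ a b = mid (third a b) ∷ mid b ∷ sub (third a b) (mid a) ∷ sub b (mid a) ∷ []

  corner-certificate : ∀ a b → a ≢ b → Certificate (cornerˡ a b) (cornerʳ a b)
  corner-certificate = distinct-pairs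
    (λ a b _ → certificate? (cornerˡ a b) (cornerʳ a b))
    (λ _ → tt) (λ _ → tt) (λ _ → tt) (λ _ → tt) (λ _ → tt) (λ _ → tt)

-- Near the glue vertex of copies i and e of S_(4+k), the corner block of copy i at
-- corner e and the corner block of copy e at corner i meet.  Labels name the vertices
-- of the two blocks; members are the glue vertex and the inner vertices of both blocks.
data GlueLabel : Set where
  inL inR : Vtx 3 → GlueLabel

data GlueMember : Set where
  glue      : GlueMember
  memL memR : Inner 3 → GlueMember

module GlueChart (k : ℕ) (i e : Fin 3) (i≢e : i ≢ e) where

  image : GlueLabel → Vtx (suc (3 ℕ.+ k))
  image (inL v) = emb i (block k e v)
  image (inR v) = emb e (block k i v)

  glue-vertex : image (inL (ext e)) ≡ inn (mid (third i e))
  glue-vertex = trans (cong (emb i) (block-corner k e)) (emb-glue i e i≢e)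

  glue-vertex′ : image (inR (ext i)) ≡ inn (mid (third i e))
  glue-vertex′ = trans (cong (emb e) (block-corner k i))
                       (trans (emb-glue e i (i≢e ∘ sym)) (cong (inn ∘ mid) (third-comm e i (i≢e ∘ sym))))

  glue-image : image (inL (ext e)) ≡ image (inR (ext i))
  glue-image = trans glue-vertex (sym glue-vertex′)

  crossing : ∀ {v w} → image (inL v) ≡ image (inR w) → v ≡ ext e × w ≡ ext i
  crossing eq with emb-overlap i e _ _ i≢e eq
  ... | eq₁ , eq₂ = block-at-corner k e eq₁ , block-at-corner k i eq₂

  sameImage? : ∀ x y → Dec (image x ≡ image y)
  sameImage? (inL v) (inL w) = map′ (cong (emb i ∘ block k e)) (block-injective k e ∘ emb-injective i) (v ≟ⱽ w)
  sameImage? (inR v) (inR w) = map′ (cong (emb e ∘ block k i)) (block-injective k i ∘ emb-injective e) (v ≟ⱽ w)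
  sameImage? (inL v) (inR w) = map′ (λ { (refl , refl) → glue-image }) crossing ((v ≟ⱽ ext e) ×-dec (w ≟ⱽ ext i))
  sameImage? (inR v) (inL w) = map′ (λ { (refl , refl) → sym glue-image }) (λ eq → let p , q = crossing (sym eq) in q , p)
                                    ((v ≟ⱽ ext i) ×-dec (w ≟ⱽ ext e))

  label : GlueMember → GlueLabel
  label glue     = inL (ext e)
  label (memL u) = inL (inn u)
  label (memR u) = inR (inn u)

  site : GlueMember → Inner (suc (3 ℕ.+ k))
  site glue     = mid (third i e)
  site (memL u) = sub i (block-inner k e u)
  site (memR u) = sub e (block-inner k i u)

  site-label : ∀ m → inn (site m) ≡ image (label m)
  site-label glue     = sym glue-vertex
  site-label (memL u) = sym (trans (cong (emb i) (block-inn k e u)) (emb-inn i _))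
  site-label (memR u) = sym (trans (cong (emb e) (block-inn k i u)) (emb-inn e _))

  nbrs : GlueMember → List GlueLabel
  nbrs glue     = map inL (neighbours 3 (ext e)) ++ map inR (neighbours 3 (ext i))
  nbrs (memL u) = map inL (neighbours 3 (inn u))
  nbrs (memR u) = map inR (neighbours 3 (inn u))

  listed : ∀ (side : Vtx 3 → GlueLabel) x {y} → Adj 3 x y →
           Any (λ g → image (side y) ≡ image g) (map side (neighbours 3 x))
  listed side x a = AnyP.map⁺ (Any.map (cong (image ∘ side)) (neighbours-complete 3 x a))

  nbrs-complete : ∀ m {w} → Adj (suc (3 ℕ.+ k)) (inn (site m)) w → Any (λ g → w ≡ image g) (nbrs m)
  nbrs-complete m a = complete m (subst (λ z → Adj _ z _) (site-label m) a)
    where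
    complete : ∀ m {w} → Adj (suc (3 ℕ.+ k)) (image (label m)) w → Any (λ g → w ≡ image g) (nbrs m)
    complete glue a with emb-neighbour i (block k e (ext e)) a
    ... | inj₁ (y , refl , p) with block-neighbour k e corner p
    ...   | y′ , refl , q = AnyP.++⁺ˡ (listed inL (ext e) q)
    complete glue a | inj₂ (e′ , _ , eq , y , refl , p) with trans (sym (block-corner k e)) eq
    ...   | refl with block-neighbour k i corner (subst (λ z → Adj _ z y) (sym (block-corner k i)) p)
    ...     | y′ , refl , q = AnyP.++⁺ʳ (map inL (neighbours 3 (ext e))) (listed inR (ext i) q)
    complete (memL u) a with emb-neighbour i (block k e (inn u)) a
    ... | inj₁ (y , refl , p) with block-neighbour k e (inner u) p
    ...   | y′ , refl , q = listed inL (inn u) q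
    complete (memL u) a | inj₂ (_ , _ , eq , _) = ⊥-elim (block-inner-not-ext k e u eq)
    complete (memR u) a with emb-neighbour e (block k i (inn u)) a
    ... | inj₁ (y , refl , p) with block-neighbour k i (inner u) p
    ...   | y′ , refl , q = listed inR (inn u) q
    complete (memR u) a | inj₂ (_ , _ , eq , _) = ⊥-elim (block-inner-not-ext k i u eq)

  nbrs-sound : ∀ m {g} → g ∈ nbrs m → Adj (suc (3 ℕ.+ k)) (inn (site m)) (image g)
  nbrs-sound m mg = subst (λ z → Adj _ z _) (sym (site-label m)) (sound m mg)
    where
    sound : ∀ m {g} → g ∈ nbrs m → Adj (suc (3 ℕ.+ k)) (image (label m)) (image g)
    sound glue mg with ∈-++⁻ (map inL (neighbours 3 (ext e))) mg
    ... | inj₁ m₁ with ∈-map⁻ inL m₁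
    ...   | y , my , refl = lift i (block-adj k e (neighbours-sound 3 (ext e) my))
    sound glue mg | inj₂ m₂ with ∈-map⁻ inR m₂
    ...   | y , my , refl = subst (λ z → Adj _ z (image (inR y))) (sym glue-image) (lift e (block-adj k i (neighbours-sound 3 (ext i) my)))
    sound (memL u) mg with ∈-map⁻ inL mg
    ... | y , my , refl = lift i (block-adj k e (neighbours-sound 3 (inn u) my))
    sound (memR u) mg with ∈-map⁻ inR mg
    ... | y , my , refl = lift e (block-adj k i (neighbours-sound 3 (inn u) my))

glueChart : ∀ k i e → i ≢ e → Chart (suc (3 ℕ.+ k))
glueChart k i e i≢e = record
  { Label = GlueLabel ; image = image ; sameImage? = sameImage?
  ; Member = GlueMember ; label = label ; site = site ; site-label = site-label
  ; nbrs = nbrs ; nbrs-complete = nbrs-complete ; nbrs-sound = nbrs-sound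
  }
  where open GlueChart k i e i≢e

-- The exchanges near the glue vertex of copies i and e, with m = third i e; memL u and
-- memR u name vertices of the blocks of copy i (at corner e) and of copy e (at corner i):
--   near:  memL (sub e (mid a)) for a = i or a = m, with memL (sub i (mid i)) and
--          memL (sub m (mid m)), against memL (mid i), memL (mid e), memL (mid m),
--          both next to memR (sub i (mid e));
--   glue:  the glue vertex, memL (mid i), memR (sub i (mid i)) against
--          memL (sub e (mid i)), memR (sub i (mid i)), both next to memL (sub m (mid e)).
module GlueCertificates (k : ℕ) where

  nearˡ : Fin 3 → Fin 3 → Fin 3 → List GlueMember
  nearˡ i e a = memL (sub e (mid a)) ∷ memL (sub i (mid i)) ∷ memL (sub (third i e) (mid (third i e))) ∷
                memR (sub i (mid e)) ∷ []

  nearʳ : Fin 3 → Fin 3 → List GlueMember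
  nearʳ i e = memL (mid i) ∷ memL (mid e) ∷ memL (mid (third i e)) ∷ memR (sub i (mid e)) ∷ []

  near-certificate : ∀ i e (ne : i ≢ e) → ChartCheck.Certificate (glueChart k i e ne) (nearˡ i e i) (nearʳ i e)
  near-certificate = distinct-pairs
    (λ i e ne → ChartCheck.certificate? (glueChart k i e ne) (nearˡ i e i) (nearʳ i e))
    (λ _ → tt) (λ _ → tt) (λ _ → tt) (λ _ → tt) (λ _ → tt) (λ _ → tt)

  near-certificate′ : ∀ i e (ne : i ≢ e) →
                      ChartCheck.Certificate (glueChart k i e ne) (nearˡ i e (third i e)) (nearʳ i e)
  near-certificate′ = distinct-pairs
    (λ i e ne → ChartCheck.certificate? (glueChart k i e ne) (nearˡ i e (third i e)) (nearʳ i e))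
    (λ _ → tt) (λ _ → tt) (λ _ → tt) (λ _ → tt) (λ _ → tt) (λ _ → tt)

  glueˡ glueʳ : Fin 3 → Fin 3 → List GlueMember
  glueˡ i e = glue ∷ memL (mid i) ∷ memR (sub i (mid i)) ∷ memL (sub (third i e) (mid e)) ∷ []
  glueʳ i e = memL (sub e (mid i)) ∷ memR (sub i (mid i)) ∷ memL (sub (third i e) (mid e)) ∷ []

  glue-certificate : ∀ i e (ne : i ≢ e) → ChartCheck.Certificate (glueChart k i e ne) (glueˡ i e) (glueʳ i e)
  glue-certificate = distinct-pairs
    (λ i e ne → ChartCheck.certificate? (glueChart k i e ne) (glueˡ i e) (glueʳ i e))
    (λ _ → tt) (λ _ → tt) (λ _ → tt) (λ _ → tt) (λ _ → tt) (λ _ → tt)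
module Weights {c ℓ} (F : Field c ℓ) where
  open Field F renaming (refl to ≈-refl; sym to ≈-sym; trans to ≈-trans)
  open GroupProperties (AbelianGroup.group +-abelianGroup) using (∙-cancelˡ; ∙-cancelʳ)
  open CSProperties +-commutativeSemigroup using (interchange)
  open import Relation.Binary.Reasoning.Setoid setoid

  sumOver : ∀ {A : Set} → (A → Carrier) → List A → Carrier
  sumOver g = foldr (λ x s → g x + s) 0#

  sumOver-map : ∀ {A B : Set} (g : B → Carrier) (h : A → B) L → sumOver g (map h L) ≈ sumOver (g ∘ h) L
  sumOver-map g h []      = ≈-refl
  sumOver-map g h (x ∷ L) = +-cong ≈-refl (sumOver-map g h L)

  sumOver-++ : ∀ {A : Set} (g : A → Carrier) L L′ → sumOver g (L ++ L′) ≈ sumOver g L + sumOver g L′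
  sumOver-++ g []      L′ = ≈-sym (+-identityˡ _)
  sumOver-++ g (x ∷ L) L′ = ≈-trans (+-cong ≈-refl (sumOver-++ g L L′)) (≈-sym (+-assoc _ _ _))

  sumOver-zero : ∀ {A : Set} (g : A → Carrier) {L} → All (λ x → g x ≈ 0#) L → sumOver g L ≈ 0#
  sumOver-zero g []         = ≈-refl
  sumOver-zero g (z ∷ zs) = ≈-trans (+-cong z (sumOver-zero g zs)) (+-identityˡ 0#)

  sumOver-pointwise : ∀ {A : Set} (g : A → Carrier) {L L′} → Pointwise (λ x y → g x ≈ g y) L L′ →
                      sumOver g L ≈ sumOver g L′
  sumOver-pointwise g []       = ≈-refl
  sumOver-pointwise g (e ∷ es) = +-cong e (sumOver-pointwise g es)


  -- The weight of S counted along L; weightOf F f S is weightOn f (allV n) S.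
  weightOn : ∀ {n} → (Vtx n → Carrier) → List (Vtx n) → VSet n → Carrier
  weightOn f L S = foldr (λ v acc → (if S v then f v else 0#) + acc) 0# L

  weightOn-cong : ∀ {n} (f : Vtx n → Carrier) L {S T : VSet n} → (∀ v → S v ≡ T v) → weightOn f L S ≡ weightOn f L T
  weightOn-cong f []      eq = refl
  weightOn-cong f (v ∷ L) eq = cong₂ (λ b r → (if b then f v else 0#) + r) (eq v) (weightOn-cong f L eq)

  weightOn-∪ : ∀ {n} (f : Vtx n → Carrier) L (S T : VSet n) → (∀ v → ¬ (S v ≡ true × T v ≡ true)) →
               weightOn f L (S ∪ T) ≈ weightOn f L S + weightOn f L T
  weightOn-∪ f []      S T disj = ≈-sym (+-identityˡ 0#)
  weightOn-∪ f (v ∷ L) S T disj =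
    ≈-trans (+-cong (split (S v) (T v) (disj v)) (weightOn-∪ f L S T disj)) (interchange _ _ _ _)
    where
    split : ∀ s t → ¬ (s ≡ true × t ≡ true) →
            (if s ∨ t then f v else 0#) ≈ (if s then f v else 0#) + (if t then f v else 0#)
    split true  true  st = ⊥-elim (st (refl , refl))
    split true  false _  = ≈-sym (+-identityʳ (f v))
    split false true  _  = ≈-sym (+-identityˡ (f v))
    split false false _  = ≈-sym (+-identityˡ 0#)

  weightOn-absent : ∀ {n} (f : Vtx n → Carrier) L {x} → x ∉ L → weightOn f L ⟨ x ⟩ ≈ 0#
  weightOn-absent f []      x∉L = ≈-refl
  weightOn-absent f (v ∷ L) {x} x∉L rewrite dec-false (x ≟ⱽ v) (x∉L ∘ here) =
    ≈-trans (+-identityˡ _) (weightOn-absent f L (x∉L ∘ there))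

  weightOn-single : ∀ {n} (f : Vtx n → Carrier) L {x} → Unique L → x ∈ L → weightOn f L ⟨ x ⟩ ≈ f x
  weightOn-single f (v ∷ L) (v∉L ∷ _) (here refl) rewrite dec-true (v ≟ⱽ v) refl =
    ≈-trans (+-cong ≈-refl (weightOn-absent f L λ m → All.lookup v∉L m refl)) (+-identityʳ (f v))
  weightOn-single f (v ∷ L) {x} (v∉L ∷ uL) (there m) rewrite dec-false (x ≟ⱽ v) (λ x≡v → All.lookup v∉L m (sym x≡v)) =
    ≈-trans (+-identityˡ _) (weightOn-single f L uL m)

  weight-⟦⟧ : ∀ {n} (f : Vtx n → Carrier) (A : List (Inner n)) → Unique A → weightOf F f ⟦ A ⟧ ≈ sumOver (f ∘ inn) A
  weight-⟦⟧ {n} f [] _ = empty (allV n)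
    where
    empty : ∀ L → weightOn f L ⟦ [] ⟧ ≈ 0#
    empty []      = ≈-refl
    empty (v ∷ L) = ≈-trans (+-identityˡ _) (empty L)
  weight-⟦⟧ {n} f (a ∷ A) (a∉A ∷ uA) =
    ≈-trans (weightOn-∪ f (allV n) ⟨ inn a ⟩ ⟦ A ⟧ apart)
          (+-cong (weightOn-single f (allV n) (unique-allV n) (∈-allV n (inn a))) (weight-⟦⟧ f A uA))
    where
    apart : ∀ v → ¬ (⟨ inn a ⟩ v ≡ true × ⟦ A ⟧ v ≡ true)
    apart v (av , Av) with from-does (inn a ≟ⱽ v) av
    ... | refl with find (⟦⟧-sound A Av)
    ...   | b , mb , refl = All.lookup a∉A mb refl

  Swappable : (n : ℕ) → (Vtx n → Carrier) → Set ℓ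
  Swappable n f = ∀ A B → Exchangeable n A B → sumOver (f ∘ inn) A ≈ sumOver (f ∘ inn) B

  -- The exchange argument: given an independent dominating set M containing ⟦ A ⟧,
  -- replacing ⟦ A ⟧ by ⟦ B ⟧ inside M gives another one.  Both are maximal independent
  -- sets, so well-coveredness equates their weights, and the common part R cancels.
  module Exchange {n} (f : Vtx n → Carrier) (wc : WellCovered F n f)
                  (A B : List (Inner n)) (ex : Exchangeable n A B)
                  (M : VSet n) (SA⊆M : ⟦ A ⟧ ⊆ᵥ M) (independentM : Independent n M)
                  (dominatingM : Dominating n M) where
    open Exchangeable ex

    SA SB : VSet n
    SA = ⟦ A ⟧
    SB = ⟦ B ⟧

    R M′ : VSet n
    R  = M ∖ SA
    M′ = R ∪ SB

    R-parts : ∀ w → R w ≡ true → M w ≡ true × SA w ≡ false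
    R-parts w h with M w | SA w
    R-parts w h  | true  | false = refl , refl
    R-parts w () | true  | true
    R-parts w () | false | _

    R-intro : ∀ w → M w ≡ true → SA w ≡ false → R w ≡ true
    R-intro w Mw SAw rewrite Mw | SAw = refl

    R-outside : ∀ w → R w ≡ true → ¬ N[ A ] w
    R-outside w h NAw with find NAw | R-parts w h
    ... | a , ma , inj₁ refl | _ , SAw with trans (sym (⟦⟧-complete A ma)) SAw
    ...   | ()
    R-outside w h NAw | a , ma , inj₂ adj | Mw , _ = independentM (inn a) w (SA⊆M _ (⟦⟧-complete A ma)) Mw adj

    outside-not-SA : ∀ w → ¬ N[ A ] w → SA w ≡ false
    outside-not-SA w ¬NAw with SA w in SAw
    ... | false = refl
    ... | true  = ⊥-elim (¬NAw (⟦⟧⊆N A SAw))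

    SB-apart : ∀ u w → SB u ≡ true → R w ≡ true → ¬ Adj n u w
    SB-apart u w SBu Rw a with find (⟦⟧-sound B SBu)
    ... | b , mb , refl = R-outside w Rw (coverʳ (lose mb (inj₂ a)))

    M′-independent : Independent n M′
    M′-independent x y M′x M′y = by-parts (∪-elim R SB M′x) (∪-elim R SB M′y)
      where
      by-parts : R x ≡ true ⊎ SB x ≡ true → R y ≡ true ⊎ SB y ≡ true → ¬ Adj n x y
      by-parts (inj₁ Rx)  (inj₁ Ry)  = independentM x y (proj₁ (R-parts x Rx)) (proj₁ (R-parts y Ry))
      by-parts (inj₁ Rx)  (inj₂ SBy) = SB-apart y x SBy Rx ∘ adj-sym
      by-parts (inj₂ SBx) (inj₁ Ry)  = SB-apart x y SBx Ry
      by-parts (inj₂ SBx) (inj₂ SBy) = ⟦⟧-independent B independentʳ x y SBx SBy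

    M′-dominating : Dominating n M′
    M′-dominating v with N[ A ]? v
    ... | yes NAv with find (coverˡ NAv)
    ...   | b , mb , inj₁ refl = inj₁ (∪-introʳ R SB (⟦⟧-complete B mb))
    ...   | b , mb , inj₂ adj  = inj₂ (inn b , ∪-introʳ R SB (⟦⟧-complete B mb) , adj)
    M′-dominating v | no ¬NAv with dominatingM v
    ...   | inj₁ Mv = inj₁ (∪-introˡ R SB (R-intro v Mv (outside-not-SA v ¬NAv)))
    ...   | inj₂ (u , Mu , adj) = inj₂ (u , ∪-introˡ R SB (R-intro u Mu (outside-not-SA u ¬NAu)) , adj)
      where
      ¬NAu : ¬ N[ A ] u
      ¬NAu NAu with find NAu
      ... | a , ma , inj₁ refl = ¬NAv (lose ma (inj₂ adj))
      ... | a , ma , inj₂ adj′ = independentM (inn a) u (SA⊆M _ (⟦⟧-complete A ma)) Mu adj′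

    M-split : ∀ w → M w ≡ (R ∪ SA) w
    M-split w with SA w in SAw
    ... | true  = trans (SA⊆M w SAw) (sym (Bool.∨-zeroʳ (M w ∧ false)))
    ... | false = sym (trans (Bool.∨-identityʳ (M w ∧ true)) (Bool.∧-identityʳ (M w)))

    weight-M : weightOf F f M ≈ weightOf F f R + weightOf F f SA
    weight-M = ≈-trans (reflexive (weightOn-cong f (allV n) M-split))
                       (weightOn-∪ f (allV n) R SA λ w (Rw , SAw) → ⊥-elim (true≢false w (R-parts w Rw) SAw))
      where
      true≢false : ∀ w → M w ≡ true × SA w ≡ false → SA w ≡ true → ⊥
      true≢false w (_ , SAw≡false) SAw with trans (sym SAw) SAw≡false
      ... | ()

    weight-M′ : weightOf F f M′ ≈ weightOf F f R + weightOf F f SB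
    weight-M′ = weightOn-∪ f (allV n) R SB λ w (Rw , SBw) → R-outside w Rw (coverʳ (⟦⟧⊆N B SBw))

    swap : sumOver (f ∘ inn) A ≈ sumOver (f ∘ inn) B
    swap = begin
      sumOver (f ∘ inn) A  ≈⟨ ≈-sym (weight-⟦⟧ f A uniqueˡ) ⟩
      weightOf F f SA      ≈⟨ ∙-cancelˡ (weightOf F f R) _ _ (begin
          weightOf F f R + weightOf F f SA  ≈⟨ ≈-sym weight-M ⟩
          weightOf F f M                    ≈⟨ wc M M′ maximal-M maximal-M′ ⟩
          weightOf F f M′                   ≈⟨ weight-M′ ⟩
          weightOf F f R + weightOf F f SB  ∎) ⟩
      weightOf F f SB      ≈⟨ weight-⟦⟧ f B uniqueʳ ⟩
      sumOver (f ∘ inn) B  ∎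
      where
      maximal-M : MaximalIndependent n M
      maximal-M = dominating⇒maximal independentM dominatingM
      maximal-M′ : MaximalIndependent n M′
      maximal-M′ = dominating⇒maximal M′-independent M′-dominating

  wellCovered⇒swappable : ∀ n f → WellCovered F n f → Swappable n f
  wellCovered⇒swappable n f wc A B ex =
    let M , SA⊆M , independentM , dominatingM = extend-to-dominating n ⟦ A ⟧ (⟦⟧-independent A independentˡ)
    in  Exchange.swap f wc A B ex M SA⊆M independentM dominatingM
    where open Exchangeable ex

  -- Swappability descends to each copy, since inner vertices of copy i keep their
  -- whole neighbourhood inside copy i.
  swappable-copy : ∀ {n} (f : Vtx (suc (suc n)) → Carrier) i →
                   Swappable (suc (suc n)) f → Swappable (suc n) (f ∘ emb i)
  swappable-copy f i sw A B ex = begin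
    sumOver (f ∘ emb i ∘ inn) A        ≈⟨ ≈-sym (in-copy A) ⟩
    sumOver (f ∘ inn) (map (sub i) A)  ≈⟨ sw _ _ (exchangeable-copy i ex) ⟩
    sumOver (f ∘ inn) (map (sub i) B)  ≈⟨ in-copy B ⟩
    sumOver (f ∘ emb i ∘ inn) B        ∎
    where
    in-copy : ∀ L → sumOver (f ∘ inn) (map (sub i) L) ≈ sumOver (f ∘ emb i ∘ inn) L
    in-copy []      = ≈-refl
    in-copy (a ∷ L) = +-cong (reflexive (cong f (sym (emb-inn i a)))) (in-copy L)

  module Charted {N} (C : Chart N) (f : Vtx N → Carrier) (sw : Swappable N f) where
    open Chart C
    open ChartCheck C

    value : Member → Carrier
    value m = f (inn (site m))

    swap-by-certificate : ∀ A B → Certificate A B → sumOver value A ≈ sumOver value B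
    swap-by-certificate A B cert = begin
      sumOver value A              ≈⟨ ≈-sym (sumOver-map (f ∘ inn) site A) ⟩
      sumOver (f ∘ inn) (map site A) ≈⟨ sw _ _ (certificate⇒exchangeable cert) ⟩
      sumOver (f ∘ inn) (map site B) ≈⟨ sumOver-map (f ∘ inn) site B ⟩
      sumOver value B              ∎

    vanish-by-swap : ∀ x Z₁ C Z₂ C′ → Certificate (x ∷ Z₁ ++ C) (Z₂ ++ C′) →
                     All (λ z → value z ≈ 0#) Z₁ → All (λ z → value z ≈ 0#) Z₂ →
                     Pointwise (λ a b → value a ≈ value b) C C′ → value x ≈ 0#
    vanish-by-swap x Z₁ C Z₂ C′ cert z₁ z₂ C≈C′ = ∙-cancelʳ (sumOver value C) (value x) 0# (begin
      value x + sumOver value C                    ≈⟨ +-cong ≈-refl (≈-sym (drop-zeros Z₁ C z₁)) ⟩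
      value x + sumOver value (Z₁ ++ C)            ≈⟨ swap-by-certificate _ _ cert ⟩
      sumOver value (Z₂ ++ C′)                     ≈⟨ drop-zeros Z₂ C′ z₂ ⟩
      sumOver value C′                             ≈⟨ ≈-sym (sumOver-pointwise value C≈C′) ⟩
      sumOver value C                              ≈⟨ ≈-sym (+-identityˡ _) ⟩
      0# + sumOver value C                         ∎)
      where
      drop-zeros : ∀ Z L → All (λ z → value z ≈ 0#) Z → sumOver value (Z ++ L) ≈ sumOver value L
      drop-zeros Z L zs = ≈-trans (sumOver-++ value Z L) (≈-trans (+-cong (sumOver-zero value zs) ≈-refl) (+-identityˡ _))

    equal-by-swap : ∀ x y C → Certificate (x ∷ C) (y ∷ C) → value x ≈ value y
    equal-by-swap x y C cert = ∙-cancelʳ (sumOver value C) (value x) (value y) (swap-by-certificate _ _ cert)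

  base-case : (f : Vtx 3 → Carrier) → Swappable 3 f → ∀ v → NonClique 3 v → f v ≈ 0#
  base-case f sw = vanish
    where
    open Charted baseChart f sw
    open BaseCertificates

    equal : ∀ a b → a ≢ b → value (sub b (mid (third a b))) ≈ value (sub b (mid a))
    equal a b ne = equal-by-swap _ _ _ (equal-certificate a b ne)

    mid-zero : ∀ a b → a ≢ b → value (mid a) ≈ 0#
    mid-zero a b ne = vanish-by-swap (mid a) [] _ [] _ (mid-certificate a b ne) [] []
                        (equal a (third a b) (third-≢ a b ne) ∷ equal a b ne ∷ ≈-refl ∷ [])

    centre-zero : ∀ a b → a ≢ b → value (sub a (mid a)) ≈ 0#
    centre-zero a b ne = vanish-by-swap (sub a (mid a)) [] _ _ _ (corner-certificate a b ne) []
                           (mid-zero (third a b) a (third-≢ a b ne ∘ sym) ∷ mid-zero b a (ne ∘ sym) ∷ [])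
                           (≈-refl ∷ ≈-refl ∷ [])

    vanish : ∀ v → NonClique 3 v → f v ≈ 0#
    vanish (ext a)                nc = ⊥-elim (nc a (inj₁ refl))
    vanish (inn (mid a))          nc = mid-zero a (next a) (next-≢ a)
    vanish (inn (sub a (mid b)))  nc with a ≟ᶠ b
    ... | yes refl = centre-zero a (next a) (next-≢ a)
    ... | no a≢b   = ⊥-elim (nc a (inj₂ (corner-adjacent a b a≢b)))
    vanish (inn (sub a (sub b ()))) nc

  near-glue : ∀ k (f : Vtx (suc (3 ℕ.+ k)) → Carrier) → Swappable (suc (3 ℕ.+ k)) f →
              ∀ i e (ne : i ≢ e) →
              (∀ w → NonClique (3 ℕ.+ k) w → f (emb i w) ≈ 0#) →
              (∀ w → NonClique (3 ℕ.+ k) w → f (emb e w) ≈ 0#) →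
              ∀ x → InSimplicialClique (3 ℕ.+ k) e x → f (emb i x) ≈ 0#
  near-glue k f sw i e ne vanishᵢ vanishₑ = vanish
    where
    open Charted (glueChart k i e ne) f sw
    open GlueChart k i e ne using (site-label)
    open ChartCheck (glueChart k i e ne) using (Certificate)
    open GlueCertificates k

    zeroL : ∀ u → NonClique 3 (inn u) → value (memL u) ≈ 0#
    zeroL u nc = ≈-trans (reflexive (cong f (site-label (memL u))))
                         (vanishᵢ _ λ j c → nc j (block-clique k e (inner u) c))

    zeroR : ∀ u → NonClique 3 (inn u) → value (memR u) ≈ 0#
    zeroR u nc = ≈-trans (reflexive (cong f (site-label (memR u))))
                         (vanishₑ _ λ j c → nc j (block-clique k i (inner u) c))

    near-zero : ∀ a → Certificate (nearˡ i e a) (nearʳ i e) → value (memL (sub e (mid a))) ≈ 0#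
    near-zero a cert = vanish-by-swap _ _ _ _ _ cert
      (zeroL _ (centre-nonclique i) ∷ zeroL _ (centre-nonclique (third i e)) ∷ [])
      (zeroL _ (mid-nonclique i) ∷ zeroL _ (mid-nonclique e) ∷ zeroL _ (mid-nonclique (third i e)) ∷ [])
      (≈-refl ∷ [])

    glue-zero : value glue ≈ 0#
    glue-zero = vanish-by-swap glue _ _ _ _ (glue-certificate i e ne)
      (zeroL _ (mid-nonclique i) ∷ zeroR _ (centre-nonclique i) ∷ [])
      (near-zero i (near-certificate i e ne) ∷ zeroR _ (centre-nonclique i) ∷ [])
      (≈-refl ∷ [])

    vanish : ∀ x → InSimplicialClique (3 ℕ.+ k) e x → f (emb i x) ≈ 0#
    vanish x (inj₁ refl) = ≈-trans (reflexive (cong f (emb-glue i e ne))) glue-zero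
    vanish x (inj₂ adj) with block-neighbour k e corner (subst (λ z → Adj _ z x) (sym (block-corner k e)) adj)
    ... | y , refl , adj′ with All.lookup (corner-neighbours i e ne) (neighbours-complete 3 (ext e) adj′)
    ...   | inj₁ refl = ≈-trans (reflexive (cong f (sym (site-label (memL _))))) (near-zero i (near-certificate i e ne))
    ...   | inj₂ refl = ≈-trans (reflexive (cong f (sym (site-label (memL _)))))
                                (near-zero (third i e) (near-certificate′ i e ne))

  -- A swappable f on S_(3+k) vanishes off the simplicial cliques, by induction on k:
  -- a vertex of copy i either lies off the cliques of copy i, or in its clique at a
  -- corner e ≠ i, i.e. next to the glue vertex of copies i and e.
  vanishing : ∀ k (f : Vtx (3 ℕ.+ k) → Carrier) → Swappable (3 ℕ.+ k) f →
              ∀ v → NonClique (3 ℕ.+ k) v → f v ≈ 0#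
  vanishing zero    f sw = base-case f sw
  vanishing (suc k) f sw v nc with in-some-copy v
  ... | i , x , refl with clique? (3 ℕ.+ k) x
  ...   | no ¬c = vanishing k (f ∘ emb i) (swappable-copy f i sw) x (λ j c → ¬c (j , c))
  ...   | yes (e , c) with i ≟ᶠ e
  ...     | yes refl = ⊥-elim (nc i (clique-emb i c))
  ...     | no i≢e = near-glue k f sw i e i≢e (vanishing k (f ∘ emb i) (swappable-copy f i sw))
                                              (vanishing k (f ∘ emb e) (swappable-copy f e sw)) x c

mainTheorem10 : ∀ {c ℓ} (F : Field c ℓ) (n : ℕ) → n ≥ 3 →
                (f : Vtx n → Field.Carrier F) → WellCovered F n f →
                ∀ (v : Vtx n) → (∀ (i : Fin 3) → ¬ InSimplicialClique n i v) →
                Field._≈_ F (f v) (Field.0# F)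
mainTheorem10 F (suc (suc (suc k))) (s≤s (s≤s (s≤s z≤n))) f wc =
  vanishing k f (wellCovered⇒swappable (3 ℕ.+ k) f wc)
  where open Weights F
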